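{- Let $k\ge 2$ be an integer, $\varepsilon$ a rational with $0<\varepsilon\le 1$, $N\ge1$, $1\le N'\le N$, and $c_1,\dots,c_{N'}\in\{1,2\}$ arbitrary labels. Define $\tau_0=2^{N+2}$, $\rho_0=2^{N+3}$, and for $i=1,\dots,N'$: $x_i=\frac{\tau_{i-1}+\rho_{i-1}}{2}$; if $c_i=1$ then $(\tau_i,\rho_i)=(\tau_{i-1},x_i)$, and if $c_i=2$ then $(\tau_i,\rho_i)=(x_i,\rho_{i-1})$. Let $b_i=1-\varepsilon\cdot k^{ -x_i}$. Then every $b_i$ lies in $\left(1-\varepsilon k^{ -2^{N+2}},\ 1-\varepsilon k^{ -2^{N+3}}\right)$, and for any $i_s$ with $c_{i_s}=1$ and any $i_l$ with $c_{i_l}=2$, we have $1-b_{i_l}>k\cdot(1-b_{i_s})$.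
   Context: This is procedure LARGE for online bin packing with cardinality constraint $k$: item $i$ has size $b_i$; after the algorithm packs item $i$, exactly one of two packing-dependent conditions $C_1$ (label $c_i=1$, "small" item, referring to $1-b_i$) or $C_2$ (label $c_i=2$, "large" item) holds. The labels may be any sequence in $\{1,2\}$. -}

module Defs where

open import Data.Nat using (ℕ; zero; suc; _+_; _^_; ⌊_/2⌋)
open import Data.Nat.Properties using (m^n≢0)
open import Data.Integer using (+_)
open import Data.Rational using (ℚ; _/_; 0ℚ; 1ℚ; _-_; _*_)
open import Data.Product using (_×_; _,_; proj₁; proj₂)

-- Item labels: c_i = 1 ("small", condition C1) or c_i = 2 ("large", condition C2)
data Label : Set where
  one two : Label

-- midpoint (τ + ρ)/2; in the construction τ+ρ is always even, so this is exact
mid : ℕ × ℕ → ℕ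
mid (τ , ρ) = ⌊ (τ + ρ) /2⌋

step : ℕ × ℕ → Label → ℕ × ℕ
step (τ , ρ) one = (τ , mid (τ , ρ))
step (τ , ρ) two = (mid (τ , ρ) , ρ)

-- (τ_i , ρ_i) for the label sequence c (c i is the label of item i, i ≥ 1)
tr : (N : ℕ) → (ℕ → Label) → ℕ → ℕ × ℕ
tr N c zero    = (2 ^ (N + 2) , 2 ^ (N + 3))
tr N c (suc i) = step (tr N c i) (c (suc i))

x : (N : ℕ) → (ℕ → Label) → ℕ → ℕ
x N c zero    = 0   -- unused (items are indexed from 1)
x N c (suc i) = mid (tr N c i)

-- k^{-e} as a rational (junk value 0 for k = 0, which is excluded by k ≥ 2)
invPow : ℕ → ℕ → ℚ
invPow zero    e = 0ℚ
invPow (suc m) e = _/_ (+ 1) (suc m ^ e) {{m^n≢0 (suc m) e}}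

b : (k N : ℕ) → ℚ → (ℕ → Label) → ℕ → ℚ
b k N ε c i = 1ℚ - ε * invPow k (x N c i)

-- The pairs (τᵢ , ρᵢ) form a nested sequence of intervals of natural
-- numbers; while i ≤ N the width ρᵢ - τᵢ is the power of two 2^(N-i+2),
-- so every midpoint xᵢ₊₁ is an exact midpoint lying at distance ≥ 4 from
-- both endpoints of (τᵢ , ρᵢ).  A small item (label one) becomes the new
-- right endpoint and a large item (label two) the new left endpoint, so
-- every later midpoint stays on the correct side of it.
module Submission where

open import Defs
open import Data.Nat using (ℕ; _≤_; _+_; _^_)
open import Data.Integer using (+_)
open import Data.Rational as Q using (ℚ; 0ℚ; 1ℚ; _-_; _*_; _<_; _>_; _/_)
open import Data.Product using (_×_)
open import Relation.Binary.PropositionalEquality using (_≡_)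

open import Data.Nat as ℕ using (suc; zero; s≤s; z≤n; _∸_; _≤′_; ≤′-refl; ≤′-step; ⌊_/2⌋)
open import Data.Nat.Properties
open import Data.Nat.Tactic.RingSolver using (solve-∀)
import Data.Integer as ℤ
import Data.Integer.Properties as ℤP
open import Data.Rational using (toℚᵘ)
import Data.Rational.Properties as QP
open import Data.Rational.Solver using (module +-*-Solver)
open import Data.Rational.Unnormalised as U using (mkℚᵘ; *<*)
import Data.Rational.Unnormalised.Properties as UP
open import Data.Product using (_,_; proj₁; proj₂)
open import Function using (flip)
open import Level using (0ℓ)
open import Relation.Binary using (Rel; Reflexive; Transitive; tri<; tri≈; tri>)
open import Relation.Binary.PropositionalEquality using (refl; sym; trans; cong; subst; subst₂; module ≡-Reasoning)

mid-even : ∀ {τ ρ} d → ρ ≡ τ + (d + d) → mid (τ , ρ) ≡ τ + d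
mid-even {τ} d refl = begin
  ⌊ τ + (τ + (d + d)) /2⌋ ≡⟨ cong ⌊_/2⌋ (shuffle τ d) ⟩
  ⌊ (τ + d) + (τ + d) /2⌋ ≡⟨ sym (n≡⌊n+n/2⌋ (τ + d)) ⟩
  τ + d                   ∎
  where
  open ≡-Reasoning
  shuffle : ∀ a b → a + (a + (b + b)) ≡ (a + b) + (a + b)
  shuffle = solve-∀

mid-inside : ∀ {τ ρ} → τ ≤ ρ → τ ≤ mid (τ , ρ) × mid (τ , ρ) ≤ ρ
mid-inside {τ} {ρ} τ≤ρ =
  ≤-trans (≤-reflexive (n≡⌊n+n/2⌋ τ)) (⌊n/2⌋-mono (+-monoʳ-≤ τ τ≤ρ)) ,
  ≤-trans (⌊n/2⌋-mono (+-monoˡ-≤ ρ τ≤ρ)) (≤-reflexive (sym (n≡⌊n+n/2⌋ ρ)))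

step-nested : ∀ {τ ρ} l → τ ≤ ρ →
  let (τ′ , ρ′) = step (τ , ρ) l in τ′ ≤ ρ′ × τ ≤ τ′ × ρ′ ≤ ρ
step-nested one τ≤ρ = let (τ≤m , m≤ρ) = mid-inside τ≤ρ in τ≤m , ≤-refl , m≤ρ
step-nested two τ≤ρ = let (τ≤m , m≤ρ) = mid-inside τ≤ρ in m≤ρ , τ≤m , ≤-refl

step-halves : ∀ {τ ρ} d l → ρ ≡ τ + (d + d) →
  let (τ′ , ρ′) = step (τ , ρ) l in ρ′ ≡ τ′ + d
step-halves d one ρ≡ = mid-even d ρ≡
step-halves {τ} d two refl rewrite mid-even {τ} d refl = sym (+-assoc τ d d)

chain : (_∼_ : Rel ℕ 0ℓ) → Reflexive _∼_ → Transitive _∼_ →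
  (f : ℕ → ℕ) → (∀ n → f n ∼ f (suc n)) → ∀ {i m} → i ≤′ m → f i ∼ f m
chain _∼_ refl′ trans′ f next ≤′-refl = refl′
chain _∼_ refl′ trans′ f next {i} (≤′-step {m} i≤′m) =
  trans′ {f i} {f m} {f (suc m)} (chain _∼_ refl′ trans′ f next i≤′m) (next m)

pow2-double : ∀ n → 2 ^ suc n ≡ 2 ^ n + 2 ^ n
pow2-double n = cong (λ m → 2 ^ n + m) (+-identityʳ (2 ^ n))

module Bisection (N : ℕ) (c : ℕ → Label) where

  T R : ℕ → ℕ
  T i = proj₁ (tr N c i)
  R i = proj₂ (tr N c i)

  initial-width : R 0 ≡ T 0 + 2 ^ (N + 2)
  initial-width = trans (cong (2 ^_) (+-suc N 2)) (pow2-double (N + 2))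

  T≤R : ∀ i → T i ≤ R i
  T≤R zero    = ≤-trans (m≤m+n (T 0) _) (≤-reflexive (sym initial-width))
  T≤R (suc i) = proj₁ (step-nested (c (suc i)) (T≤R i))

  T-mono : ∀ {i m} → i ≤ m → T i ≤ T m
  T-mono i≤m = chain _≤_ ≤-refl ≤-trans T
    (λ n → proj₁ (proj₂ (step-nested (c (suc n)) (T≤R n)))) (≤⇒≤′ i≤m)

  R-anti : ∀ {i m} → i ≤ m → R m ≤ R i
  R-anti i≤m = chain (flip _≤_) ≤-refl (λ p q → ≤-trans q p) R
    (λ n → proj₂ (proj₂ (step-nested (c (suc n)) (T≤R n)))) (≤⇒≤′ i≤m)

  width : ∀ i j → i + j ≡ N → R i ≡ T i + 2 ^ (j + 2)
  halving : ∀ i j → suc i + j ≡ N → R i ≡ T i + (2 ^ (j + 2) + 2 ^ (j + 2))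

  width zero    j refl = initial-width
  width (suc i) j eq   = step-halves (2 ^ (j + 2)) (c (suc i)) (halving i j eq)

  halving i j eq = trans (width i (suc j) (trans (+-suc i j) eq))
                         (cong (λ w → T i + w) (pow2-double (j + 2)))

  margins : ∀ i → suc i ≤ N → 4 + T i ≤ x N c (suc i) × 4 + x N c (suc i) ≤ R i
  margins i i<N =
    ≤-trans (+-monoˡ-≤ (T i) 4≤d) (≤-reflexive (sym x≡)) ,
    ≤-trans (+-monoˡ-≤ (x N c (suc i)) 4≤d) (≤-reflexive R≡)
    where
    j = N ∸ suc i
    d = 2 ^ (j + 2)
    R≡T+2d : R i ≡ T i + (d + d)
    R≡T+2d = halving i j (m+[n∸m]≡n i<N)
    x≡ : x N c (suc i) ≡ d + T i
    x≡ = trans (mid-even d R≡T+2d) (+-comm (T i) d)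
    R≡ : d + x N c (suc i) ≡ R i
    R≡ = begin
      d + x N c (suc i) ≡⟨ cong (λ y → d + y) x≡ ⟩
      d + (d + T i)     ≡⟨ sym (+-assoc d d (T i)) ⟩
      (d + d) + T i     ≡⟨ +-comm (d + d) (T i) ⟩
      T i + (d + d)     ≡⟨ sym R≡T+2d ⟩
      R i               ∎
      where open ≡-Reasoning
    4≤d : 4 ≤ d
    4≤d = ^-monoʳ-≤ 2 (m≤n+m 2 j)

  small-is-right : ∀ i → c (suc i) ≡ one → R (suc i) ≡ x N c (suc i)
  small-is-right i cᵢ≡one rewrite cᵢ≡one = refl

  large-is-left : ∀ i → c (suc i) ≡ two → T (suc i) ≡ x N c (suc i)
  large-is-left i cᵢ≡two rewrite cᵢ≡two = refl

  x-bounds : ∀ i → 1 ≤ i → i ≤ N → 2 ^ (N + 2) ℕ.< x N c i × x N c i ℕ.< 2 ^ (N + 3)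
  x-bounds (suc i) _ i<N =
    ≤-trans (s≤s (T-mono {0} {i} z≤n)) (≤-trans (m≤n+m (suc (T i)) 3) lo) ,
    ≤-trans (m≤n+m (suc (x N c (suc i))) 3) (≤-trans hi (R-anti {0} {i} z≤n))
    where
    lo = proj₁ (margins i i<N)
    hi = proj₂ (margins i i<N)

  -- (b) A small item's midpoint exceeds a large item's midpoint by ≥ 4:
  -- the earlier of the two items bounds every later midpoint.
  x-gap : ∀ s l → 1 ≤ s → s ≤ N → 1 ≤ l → l ≤ N → c s ≡ one → c l ≡ two →
          4 + x N c l ≤ x N c s
  x-gap (suc s) (suc l) _ s<N _ l<N cₛ≡one cₗ≡two with <-cmp s l
  ... | tri< s<l _ _ =
    ≤-trans (proj₂ (margins l l<N)) (≤-trans (R-anti s<l) (≤-reflexive (small-is-right s cₛ≡one)))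
  ... | tri> _ _ l<s =
    ≤-trans (+-monoʳ-≤ 4 (≤-trans (≤-reflexive (sym (large-is-left l cₗ≡two))) (T-mono l<s)))
            (proj₁ (margins s s<N))
  ... | tri≈ _ refl _ with trans (sym cₛ≡one) cₗ≡two
  ...   | ()

scaled-unit-fraction-< : ∀ a d e .{{_ : ℕ.NonZero d}} .{{_ : ℕ.NonZero e}} →
  a ℕ.* e ℕ.< d → (+ a / 1) * (+ 1 / d) < + 1 / e
scaled-unit-fraction-< a (suc d) (suc e) ae<d = QP.toℚᵘ-cancel-< (begin-strict
  toℚᵘ ((+ a / 1) * (+ 1 / suc d))       ≃⟨ QP.toℚᵘ-homo-* (+ a / 1) (+ 1 / suc d) ⟩
  toℚᵘ (+ a / 1) U.* toℚᵘ (+ 1 / suc d)  ≃⟨ UP.*-cong (QP.toℚᵘ-fromℚᵘ (mkℚᵘ (+ a) 0))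
                                                      (QP.toℚᵘ-fromℚᵘ (mkℚᵘ (+ 1) d)) ⟩
  mkℚᵘ (+ a) 0 U.* mkℚᵘ (+ 1) d          <⟨ *<* cross ⟩
  mkℚᵘ (+ 1) e                           ≃⟨ UP.≃-sym (QP.toℚᵘ-fromℚᵘ (mkℚᵘ (+ 1) e)) ⟩
  toℚᵘ (+ 1 / suc e)                     ∎)
  where
  open UP.≤-Reasoning
  cross : (+ a ℤ.* + 1) ℤ.* + suc e ℤ.< + 1 ℤ.* + (1 ℕ.* suc d)
  cross = subst₂ ℤ._<_
    (trans (ℤP.pos-* a (suc e)) (cong (ℤ._* + suc e) (sym (ℤP.*-identityʳ (+ a)))))
    (trans (cong +_ (sym (*-identityˡ (suc d)))) (sym (ℤP.*-identityˡ _)))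
    (ℤ.+<+ ae<d)

invPow-antitone : ∀ k → 2 ≤ k → ∀ {e f} → e ℕ.< f → invPow k f < invPow k e
invPow-antitone k@(suc _) 1<k {e} {f} e<f =
  subst (_< invPow k e) (QP.*-identityˡ (invPow k f))
    (scaled-unit-fraction-< 1 (k ^ f) (k ^ e) {{m^n≢0 k f}} {{m^n≢0 k e}}
      (subst (ℕ._< k ^ f) (sym (*-identityˡ (k ^ e))) (^-monoʳ-< k 1<k e<f)))

invPow-scaled : ∀ k → 2 ≤ k → ∀ {e f} → suc e ℕ.< f → (+ k / 1) * invPow k f < invPow k e
invPow-scaled k@(suc _) 1<k {e} {f} 1+e<f =
  scaled-unit-fraction-< k (k ^ f) (k ^ e) {{m^n≢0 k f}} {{m^n≢0 k e}} (^-monoʳ-< k 1<k 1+e<f)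

one-minus-antitone : ∀ {p q} → p < q → 1ℚ - q < 1ℚ - p
one-minus-antitone p<q = QP.+-monoʳ-< 1ℚ (QP.neg-antimono-< p<q)

one-minus-scaled-mono : ∀ k → 2 ≤ k → ∀ ε → .{{Q.Positive ε}} → ∀ {e f} → e ℕ.< f →
  1ℚ - ε * invPow k e < 1ℚ - ε * invPow k f
one-minus-scaled-mono k 1<k ε e<f =
  one-minus-antitone (QP.*-monoʳ-<-pos ε (invPow-antitone k 1<k e<f))

scaled-gap : ∀ k → 2 ≤ k → ∀ ε → .{{Q.Positive ε}} → ∀ {e f} → suc e ℕ.< f →
  (+ k / 1) * (ε * invPow k f) < ε * invPow k e
scaled-gap k 1<k ε {e} {f} 1+e<f = subst (_< ε * invPow k e) (swap (+ k / 1) ε (invPow k f))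
  (QP.*-monoʳ-<-pos ε (invPow-scaled k 1<k 1+e<f))
  where
  open +-*-Solver
  swap : ∀ p q r → q * (p * r) ≡ p * (q * r)
  swap = solve 3 (λ p q r → q :* (p :* r) := p :* (q :* r)) refl

one-minus-b : ∀ k N ε c i → 1ℚ - b k N ε c i ≡ ε * invPow k (x N c i)
one-minus-b k N ε c i = involutive (ε * invPow k (x N c i))
  where
  open +-*-Solver
  involutive : ∀ q → 1ℚ - (1ℚ - q) ≡ q
  involutive = solve 1 (λ q → con 1ℚ :- (con 1ℚ :- q) := q) refl

corollary4 : (k : ℕ) → 2 ≤ k → (ε : ℚ) → 0ℚ < ε → ε Q.≤ 1ℚ →
    (N N' : ℕ) → 1 ≤ N → 1 ≤ N' → N' ≤ N → (c : ℕ → Label) →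
    ((i : ℕ) → 1 ≤ i → i ≤ N' →
        (1ℚ - ε * invPow k (2 ^ (N + 2)) < b k N ε c i)
        × (b k N ε c i < 1ℚ - ε * invPow k (2 ^ (N + 3))))
    × ((is il : ℕ) → 1 ≤ is → is ≤ N' → 1 ≤ il → il ≤ N' →
        c is ≡ one → c il ≡ two →
        1ℚ - b k N ε c il > (+ k / 1) * (1ℚ - b k N ε c is))
corollary4 k 1<k ε 0<ε _ N N' _ _ N'≤N c = item-bounds , item-gap
  where
  open Bisection N c using (x-bounds; x-gap)
  instance
    ε-positive : Q.Positive ε
    ε-positive = Q.positive 0<ε

  item-bounds : (i : ℕ) → 1 ≤ i → i ≤ N' →
    (1ℚ - ε * invPow k (2 ^ (N + 2)) < b k N ε c i) × (b k N ε c i < 1ℚ - ε * invPow k (2 ^ (N + 3)))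
  item-bounds i 1≤i i≤N' =
    let (lo , hi) = x-bounds i 1≤i (≤-trans i≤N' N'≤N)
    in one-minus-scaled-mono k 1<k ε lo , one-minus-scaled-mono k 1<k ε hi

  item-gap : (s l : ℕ) → 1 ≤ s → s ≤ N' → 1 ≤ l → l ≤ N' → c s ≡ one → c l ≡ two →
    (+ k / 1) * (1ℚ - b k N ε c s) < 1ℚ - b k N ε c l
  item-gap s l 1≤s s≤N' 1≤l l≤N' cₛ≡one cₗ≡two =
    subst₂ (λ u v → (+ k / 1) * u < v) (sym (one-minus-b k N ε c s)) (sym (one-minus-b k N ε c l))
      (scaled-gap k 1<k ε (≤-trans (m≤n+m (2 + x N c l) 2)
        (x-gap s l 1≤s (≤-trans s≤N' N'≤N) 1≤l (≤-trans l≤N' N'≤N) cₛ≡one cₗ≡two)))
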